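{- For any positive integers $a$ and $b$ and any nonnegative integer $c$, $$f_{a,b,c}(x) = 1 + x f_{a-1, b, c}(x) + \sum_{r=2}^a x^r f_{a-r+1,b,c}(x) + \frac{x^{a+1}}{1-x} f_{0,b,c}(x).$$
   Context: $S_n$ is the set of permutations of $\{1,\dots,n\}$ in one-line notation; $\pi$ avoids $\sigma\in S_k$ if no subsequence of $\pi$ of length $k$ has the same relative order as $\sigma$; $S_n(R)$ is the set of $\pi\in S_n$ avoiding every element of $R$, and $S_0(R)$ contains only the empty permutation. For nonnegative integers $a,b,c$, $\gamma_{a,b,c}\in S_{a+b+c+1}$ is $$\gamma_{a,b,c} = a+b+c+1, a+b+c, \ldots, b+c+2,\ b+c, b+c-1, \ldots, c+1,\ b+c+1,\ c, c-1, \ldots, 2, 1,$$ and $f_{a,b,c}(x) = \sum_{n\ge 0} |S_n(123, 132, \gamma_{a,b,c})| x^n$. -}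

module Defs where

open import Data.Nat using (ℕ; zero; suc; _+_; _∸_; _<ᵇ_; _≡ᵇ_; _≤ᵇ_)
open import Data.Bool using (Bool; true; false; _∧_; _∨_; not; if_then_else_)
open import Data.List using (List; []; _∷_; map; concatMap; applyUpTo; filterᵇ; length; zip; _++_; [_])
open import Data.Bool.ListAction using (all; any)
open import Data.Product using (_,_)

_==_ : Bool → Bool → Bool
true  == b = b
false == b = not b

subseqs : List ℕ → List (List ℕ)
subseqs []       = [ [] ]
subseqs (x ∷ xs) = let r = subseqs xs in map (x ∷_) r ++ r

sameOrder : List ℕ → List ℕ → Bool
sameOrder []       []       = true
sameOrder []       (_ ∷ _)  = false
sameOrder (_ ∷ _)  []       = false
sameOrder (x ∷ xs) (y ∷ ys) =
  all (λ { (z , w) → ((x <ᵇ z) == (y <ᵇ w)) ∧ ((z <ᵇ x) == (w <ᵇ y)) }) (zip xs ys)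
  ∧ sameOrder xs ys

contains : List ℕ → List ℕ → Bool
contains π σ = any (sameOrder σ) (subseqs π)

avoids : List ℕ → List ℕ → Bool
avoids π σ = not (contains π σ)

avoidsAll : List ℕ → List (List ℕ) → Bool
avoidsAll π R = all (avoids π) R

words : ℕ → ℕ → List (List ℕ)
words n zero    = [ [] ]
words n (suc l) = concatMap (λ x → map (x ∷_) (words n l)) (applyUpTo suc n)

distinct : List ℕ → Bool
distinct []       = true
distinct (x ∷ xs) = all (λ y → not (x ≡ᵇ y)) xs ∧ distinct xs

perms : ℕ → List (List ℕ)
perms n = filterᵇ distinct (words n n)

countAvoiders : List (List ℕ) → ℕ → ℕ
countAvoiders R n = length (filterᵇ (λ π → avoidsAll π R) (perms n))

descRange : ℕ → ℕ → List ℕ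
descRange s zero    = []
descRange s (suc l) = s ∷ descRange (s ∸ 1) l

-- γ_{a,b,c} = a+b+c+1, …, b+c+2, b+c, …, c+1, b+c+1, c, …, 1
γ : ℕ → ℕ → ℕ → List ℕ
γ a b c = descRange (a + b + c + 1) a ++ descRange (b + c) b
          ++ (b + c + 1) ∷ descRange c c

p123 p132 : List ℕ
p123 = 1 ∷ 2 ∷ 3 ∷ []
p132 = 1 ∷ 3 ∷ 2 ∷ []

FPS : Set
FPS = ℕ → ℕ

-- f_{a,b,c}(x) = Σ_n |S_n(123,132,γ_{a,b,c})| xⁿ
f : ℕ → ℕ → ℕ → FPS
f a b c n = countAvoiders (p123 ∷ p132 ∷ γ a b c ∷ []) n

oneS : FPS
oneS zero    = 1
oneS (suc _) = 0

zeroS : FPS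
zeroS _ = 0

_⊕_ : FPS → FPS → FPS
(F ⊕ G) n = F n + G n
infixl 6 _⊕_

xPow : ℕ → FPS → FPS
xPow r F n = if n <ᵇ r then 0 else F (n ∸ r)

-- F / (1 - x) : n-th coefficient is Σ_{k ≤ n} F k
geom : FPS → FPS
geom F zero    = F zero
geom F (suc n) = geom F n + F (suc n)

sumS : List FPS → FPS
sumS []       = zeroS
sumS (F ∷ Fs) = F ⊕ sumS Fs

from2to : ℕ → List ℕ
from2to a = applyUpTo (λ i → i + 2) (a ∸ 1)

-- A 123,132-avoiding permutation of length n + 1 is (n, n - 1, …, n - k + 1, n + 1) followed by
-- a 123,132-avoiding permutation ρ of {1, …, n - k}: the entries before the maximum decrease and
-- exceed all later ones. A copy of γ_{a,b,c} can put into that prefix only an initial part of its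
-- first decreasing run, of length at most max(1, k): the prefix has no 312 and no ascent followed by
-- a further entry, while (as b ≥ 1) γ continues with the ascent b + c < b + c + 1. Hence the
-- permutation avoids γ_{a,b,c} iff ρ avoids γ_{a - max(1,k),b,c}, so
-- f_{a,b,c}[n + 1] = Σ_{k ≤ n} f_{a - max(1,k),b,c}[n - k]. The term k = 0, the terms 1 ≤ k < a and
-- the terms k ≥ a (all involving f_{0,b,c}) give the three summands of the identity.

module Submission where

open import Defs
open import Data.Bool using (Bool; true; false; not; _∧_; T; T?)
open import Data.Bool.Properties using (T-∧; T-≡)
open import Data.Bool.ListAction using (all)
open import Data.Empty using (⊥; ⊥-elim)
open import Data.List using (List; []; _∷_; [_]; _++_; map; concat; concatMap; applyUpTo; filterᵇ; length; zip; take; drop)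
open import Data.List.Membership.Propositional using (_∈_; _∉_; find; lose)
open import Data.List.Membership.Propositional.Properties using (∈-concat⁺′; ∈-concat⁻′; ∈-filter⁺; ∈-filter⁻; ∈-++⁺ˡ; ∈-++⁺ʳ; ∈-++⁻; ∈-map⁺; ∈-map⁻; ∈-∃++; ∈-applyUpTo⁺; ∈-applyUpTo⁻; ∈-concatMap⁺; ∈-concatMap⁻)
open import Data.List.Properties using (length-map; map-applyUpTo; ++-cancelˡ; length-applyUpTo; ∷-injectiveˡ; ∷-injectiveʳ; length-++; length-take; take++drop≡id; ++-assoc; ++-identityʳ)
open import Data.List.Relation.Binary.Pointwise as Pointwise using (Pointwise; []; _∷_)
open import Data.List.Relation.Binary.Sublist.Propositional using (_⊆_; []; _∷_; _∷ʳ_; minimum; from∈; ⊆-refl; ⊆-trans)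
open import Data.List.Relation.Binary.Sublist.Propositional.Properties using (All-resp-⊆; Any-resp-⊆; ++⁺; ++⁺ˡ; ++⁺ʳ; ∷ˡ⁻; drop-⊆; take-⊆; length-mono-≤)
open import Data.List.Relation.Unary.All as All using (All; []; _∷_)
import Data.List.Relation.Unary.All.Properties as All
import Data.List.Relation.Unary.Any.Properties as Any
open import Data.List.Relation.Unary.Any using (here; there)
open import Data.List.Relation.Unary.AllPairs as AllPairs using (AllPairs; []; _∷_)
import Data.List.Relation.Unary.AllPairs.Properties as AllPairs
open import Data.List.Relation.Unary.Unique.Propositional using (Unique)
import Data.List.Relation.Unary.Unique.Propositional.Properties as Unique
open import Data.Nat using (ℕ; zero; suc; _+_; _∸_; _⊓_; _⊔_; _≤_; _<_; z≤n; s≤s; _<ᵇ_; _≡ᵇ_)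
open import Data.Nat.ListAction using (sum)
open import Data.Nat.Properties
open import Data.List.Membership.DecPropositional _≟_ using (_∈?_)
open import Data.Product using (∃-syntax; ∃₂; _×_; _,_; proj₁; proj₂)
open import Data.Sum using (_⊎_; inj₁; inj₂; [_,_]′)
open import Function using (_∘_; Equivalence)
open import Relation.Binary.PropositionalEquality hiding ([_])
open import Relation.Nullary using (¬_; Dec; yes; no)


==⇒≡ : ∀ {a b} → T (a == b) → a ≡ b
==⇒≡ {true}  {true}  _ = refl
==⇒≡ {false} {false} _ = refl

≡⇒== : ∀ {a b} → a ≡ b → T (a == b)
≡⇒== {true}  refl = _
≡⇒== {false} refl = _

<⇒<ᵇ≡true : ∀ {m n} → m < n → (m <ᵇ n) ≡ true
<⇒<ᵇ≡true m<n = Equivalence.to T-≡ (<⇒<ᵇ m<n)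

≤⇒<ᵇ≡false : ∀ {m n} → n ≤ m → (m <ᵇ n) ≡ false
≤⇒<ᵇ≡false {m} {zero}  z≤n       = refl
≤⇒<ᵇ≡false {suc m} {suc n} (s≤s n≤m) = ≤⇒<ᵇ≡false {m} {n} n≤m

<ᵇ≡true⇒< : ∀ {m n} → (m <ᵇ n) ≡ true → m < n
<ᵇ≡true⇒< {m} {n} eq = <ᵇ⇒< m n (Equivalence.from T-≡ eq)

T-not-≡ᵇ⇒≢ : ∀ {x y} → T (not (x ≡ᵇ y)) → x ≢ y
T-not-≡ᵇ⇒≢ {x} {y} t x≡y = subst (T ∘ not) (Equivalence.to T-≡ (≡⇒≡ᵇ x y x≡y)) t

≢⇒T-not-≡ᵇ : ∀ {x y} → x ≢ y → T (not (x ≡ᵇ y))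
≢⇒T-not-≡ᵇ {x} {y} x≢y with x ≡ᵇ y in eq
... | true  = x≢y (≡ᵇ⇒≡ x y (Equivalence.from T-≡ eq))
... | false = _


module _ {A : Set} where

  ⊆-++⁻ : ∀ {t} (xs ys : List A) → t ⊆ xs ++ ys → ∃₂ λ t₁ t₂ → t ≡ t₁ ++ t₂ × t₁ ⊆ xs × t₂ ⊆ ys
  ⊆-++⁻ {t} []   ys τ          = [] , t , refl , [] , τ
  ⊆-++⁻ (x ∷ xs) ys (.x ∷ʳ τ)  with ⊆-++⁻ xs ys τ
  ... | t₁ , t₂ , refl , τ₁ , τ₂ = t₁ , t₂ , refl , x ∷ʳ τ₁ , τ₂
  ⊆-++⁻ (x ∷ xs) ys (refl ∷ τ) with ⊆-++⁻ xs ys τ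
  ... | t₁ , t₂ , refl , τ₁ , τ₂ = x ∷ t₁ , t₂ , refl , refl ∷ τ₁ , τ₂

  ⊆-[x] : ∀ {t} {x : A} → t ⊆ [ x ] → t ≡ [] ⊎ t ≡ [ x ]
  ⊆-[x] (_ ∷ʳ [])   = inj₁ refl
  ⊆-[x] (refl ∷ []) = inj₂ refl

  AllPairs-resp-⊆ : ∀ {R : A → A → Set} {t xs} → t ⊆ xs → AllPairs R xs → AllPairs R t
  AllPairs-resp-⊆ []         []       = []
  AllPairs-resp-⊆ (_ ∷ʳ τ)   (_ ∷ rs) = AllPairs-resp-⊆ τ rs
  AllPairs-resp-⊆ (refl ∷ τ) (r ∷ rs) = All-resp-⊆ τ r ∷ AllPairs-resp-⊆ τ rs

  Pointwise-++⁻ : ∀ {R : A → A → Set} {g₁ g₂ s₁ s₂} → length g₁ ≡ length s₁ →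
                  Pointwise R (g₁ ++ g₂) (s₁ ++ s₂) → Pointwise R g₁ s₁ × Pointwise R g₂ s₂
  Pointwise-++⁻ {g₁ = []}    {s₁ = []}    _   rs       = [] , rs
  Pointwise-++⁻ {g₁ = _ ∷ _} {s₁ = _ ∷ _} len (r ∷ rs) =
    let (rs₁ , rs₂) = Pointwise-++⁻ (suc-injective len) rs in r ∷ rs₁ , rs₂

  ++-[y]-⊆-take : ∀ xs {y : A} {ys j} → length xs < j → xs ++ [ y ] ⊆ take j (xs ++ y ∷ ys)
  ++-[y]-⊆-take []       {j = suc j} _            = refl ∷ minimum _
  ++-[y]-⊆-take (x ∷ xs) {j = suc j} (s≤s |xs|<j) = refl ∷ ++-[y]-⊆-take xs |xs|<j

  ∈-drop-++-∷ : ∀ xs {y : A} {ys j} → j ≤ length xs → y ∈ drop j (xs ++ y ∷ ys)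
  ∈-drop-++-∷ xs       {j = zero}  _            = ∈-++⁺ʳ xs (here refl)
  ∈-drop-++-∷ (x ∷ xs) {j = suc j} (s≤s j≤|xs|) = ∈-drop-++-∷ xs j≤|xs|

  ∈-++-∷⁻ : ∀ {x z : A} us {vs} → z ∈ us ++ x ∷ vs → z ≢ x → z ∈ us ++ vs
  ∈-++-∷⁻ []       (here refl) z≢x = ⊥-elim (z≢x refl)
  ∈-++-∷⁻ []       (there z∈)  _   = z∈
  ∈-++-∷⁻ (u ∷ us) (here refl) _   = here refl
  ∈-++-∷⁻ (u ∷ us) (there z∈)  z≢x = there (∈-++-∷⁻ us z∈ z≢x)

  ++-∷-cancel : ∀ {x : A} us us′ {vs vs′} → x ∉ us → x ∉ us′ → us ++ x ∷ vs ≡ us′ ++ x ∷ vs′ → us ≡ us′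
  ++-∷-cancel []       []         _    _     _  = refl
  ++-∷-cancel []       (u′ ∷ us′) _    x∉us′ eq = ⊥-elim (x∉us′ (here (∷-injectiveˡ eq)))
  ++-∷-cancel (u ∷ us) []         x∉us _     eq = ⊥-elim (x∉us (here (sym (∷-injectiveˡ eq))))
  ++-∷-cancel (u ∷ us) (u′ ∷ us′) x∉us x∉us′ eq =
    cong₂ _∷_ (∷-injectiveˡ eq) (++-∷-cancel us us′ (x∉us ∘ there) (x∉us′ ∘ there) (∷-injectiveʳ eq))

  Unique-++-∷⁻ : ∀ {x : A} us {vs} → Unique (us ++ x ∷ vs) → x ∉ us ++ vs
  Unique-++-∷⁻ []       (x∉vs ∷ _)   x∈          = All.lookup x∉vs x∈ refl
  Unique-++-∷⁻ (u ∷ us) (u∉rest ∷ _) (here refl) = All.lookup u∉rest (∈-++⁺ʳ us (here refl)) refl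
  Unique-++-∷⁻ (u ∷ us) (_ ∷ urest)  (there x∈)  = Unique-++-∷⁻ us urest x∈

  length-++-∷ : ∀ (us : List A) {x vs} → length (us ++ x ∷ vs) ≡ suc (length (us ++ vs))
  length-++-∷ us {x} {vs} = begin
    length (us ++ x ∷ vs)         ≡⟨ length-++ us ⟩
    length us + suc (length vs)   ≡⟨ +-suc (length us) (length vs) ⟩
    suc (length us + length vs)   ≡⟨ cong suc (length-++ us) ⟨
    suc (length (us ++ vs))       ∎
    where open ≡-Reasoning

  length-concat : ∀ (xss : List (List A)) → length (concat xss) ≡ sum (map length xss)
  length-concat []         = refl
  length-concat (xs ∷ xss) = trans (length-++ xs) (cong (length xs +_) (length-concat xss))

  Unique-length-≤ : ∀ {xs : List A} ys → Unique xs → (∀ {x} → x ∈ xs → x ∈ ys) → length xs ≤ length ys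
  Unique-length-≤ {[]}     ys _            _     = z≤n
  Unique-length-≤ {x ∷ xs} ys (x∉xs ∷ uxs) xs⊆ys with ∈-∃++ (xs⊆ys (here refl))
  ... | us , vs , refl = subst (suc (length xs) ≤_) (sym (length-++-∷ us)) (s≤s (Unique-length-≤ (us ++ vs) uxs xs⊆us++vs))
    where
    xs⊆us++vs : ∀ {z} → z ∈ xs → z ∈ us ++ vs
    xs⊆us++vs z∈ = ∈-++-∷⁻ us (xs⊆ys (there z∈)) (λ z≡x → All.lookup x∉xs z∈ (sym z≡x))

  Unique-length-≡ : ∀ {xs ys : List A} → Unique xs → Unique ys →
                    (∀ {x} → x ∈ xs → x ∈ ys) → (∀ {x} → x ∈ ys → x ∈ xs) → length xs ≡ length ys
  Unique-length-≡ {xs} {ys} uxs uys xs⊆ys ys⊆xs = ≤-antisym (Unique-length-≤ ys uxs xs⊆ys) (Unique-length-≤ xs uys ys⊆xs)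


-- Order isomorphism and pattern containment

record SameComparison (x y z w : ℕ) : Set where
  constructor sameComparison
  field
    <-agrees : (x <ᵇ z) ≡ (y <ᵇ w)
    >-agrees : (z <ᵇ x) ≡ (w <ᵇ y)

open SameComparison

<⇒SameComparison : ∀ {x y z w} → x < z → y < w → SameComparison x y z w
<⇒SameComparison x<z y<w = sameComparison
  (trans (<⇒<ᵇ≡true x<z) (sym (<⇒<ᵇ≡true y<w)))
  (trans (≤⇒<ᵇ≡false (<⇒≤ x<z)) (sym (≤⇒<ᵇ≡false (<⇒≤ y<w))))

>⇒SameComparison : ∀ {x y z w} → z < x → w < y → SameComparison x y z w
>⇒SameComparison z<x w<y = sameComparison
  (trans (≤⇒<ᵇ≡false (<⇒≤ z<x)) (sym (≤⇒<ᵇ≡false (<⇒≤ w<y))))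
  (trans (<⇒<ᵇ≡true z<x) (sym (<⇒<ᵇ≡true w<y)))

SameComparison-sym : ∀ {x y z w} → SameComparison x y z w → SameComparison y x w z
SameComparison-sym (sameComparison p q) = sameComparison (sym p) (sym q)

SameComparison-trans : ∀ {x y u z w v} → SameComparison x y z w → SameComparison y u w v → SameComparison x u z v
SameComparison-trans (sameComparison p q) (sameComparison p′ q′) = sameComparison (trans p p′) (trans q q′)

SameComparison⇒< : ∀ {x y z w} → SameComparison x y z w → x < z → y < w
SameComparison⇒< c x<z = <ᵇ≡true⇒< (trans (sym (<-agrees c)) (<⇒<ᵇ≡true x<z))

SameComparison⇒> : ∀ {x y z w} → SameComparison x y z w → z < x → w < y
SameComparison⇒> c z<x = <ᵇ≡true⇒< (trans (sym (>-agrees c)) (<⇒<ᵇ≡true z<x))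

Pointwise-All< : ∀ {x y zs ws} → Pointwise (SameComparison x y) zs ws → All (_< x) zs → All (_< y) ws
Pointwise-All< []       []         = []
Pointwise-All< (c ∷ cs) (z<x ∷ zs) = SameComparison⇒> c z<x ∷ Pointwise-All< cs zs

All<⇒Pointwise : ∀ {x y zs ws} → length zs ≡ length ws → All (_< x) zs → All (_< y) ws →
                 Pointwise (SameComparison x y) zs ws
All<⇒Pointwise {zs = []}    {[]}    _   []         []         = []
All<⇒Pointwise {zs = _ ∷ _} {_ ∷ _} len (z<x ∷ zs) (w<y ∷ ws) =
  >⇒SameComparison z<x w<y ∷ All<⇒Pointwise (suc-injective len) zs ws

data OrderIso : List ℕ → List ℕ → Set where
  []  : OrderIso [] []
  _∷_ : ∀ {x y xs ys} → Pointwise (SameComparison x y) xs ys → OrderIso xs ys → OrderIso (x ∷ xs) (y ∷ ys)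

OrderIso-refl : ∀ xs → OrderIso xs xs
OrderIso-refl []       = []
OrderIso-refl (x ∷ xs) = Pointwise.refl (sameComparison refl refl) ∷ OrderIso-refl xs

OrderIso-trans : ∀ {xs ys zs} → OrderIso xs ys → OrderIso ys zs → OrderIso xs zs
OrderIso-trans []         []         = []
OrderIso-trans (cs ∷ iso) (ds ∷ iso′) =
  Pointwise.transitive SameComparison-trans cs ds ∷ OrderIso-trans iso iso′

OrderIso-length : ∀ {xs ys} → OrderIso xs ys → length xs ≡ length ys
OrderIso-length []        = refl
OrderIso-length (_ ∷ iso) = cong suc (OrderIso-length iso)

-- Abstracted over the test p: the pattern-matching lambda inside sameOrder cannot be restated here.
module _ {x y : ℕ} (p : ℕ × ℕ → Bool) where

  all-zip⇒Pointwise : (∀ {z w} → T (p (z , w)) → SameComparison x y z w) →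
                      ∀ {zs ws} → length zs ≡ length ws → T (all p (zip zs ws)) →
                      Pointwise (SameComparison x y) zs ws
  all-zip⇒Pointwise sound {[]}     {[]}     _   _ = []
  all-zip⇒Pointwise sound {z ∷ zs} {w ∷ ws} len h =
    let (h₁ , h₂) = Equivalence.to T-∧ h
    in sound h₁ ∷ all-zip⇒Pointwise sound (suc-injective len) h₂

  Pointwise⇒all-zip : (∀ {z w} → SameComparison x y z w → T (p (z , w))) →
                      ∀ {zs ws} → Pointwise (SameComparison x y) zs ws → T (all p (zip zs ws))
  Pointwise⇒all-zip complete []       = _
  Pointwise⇒all-zip complete (c ∷ cs) = Equivalence.from T-∧ (complete c , Pointwise⇒all-zip complete cs)

sameOrder⇒OrderIso : ∀ σ s → T (sameOrder σ s) → OrderIso σ s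
sameOrder⇒OrderIso []       []       _ = []
sameOrder⇒OrderIso (x ∷ xs) (y ∷ ys) h =
  let (row , rest) = Equivalence.to T-∧ h
      iso = sameOrder⇒OrderIso xs ys rest
  in all-zip⇒Pointwise _ sound (OrderIso-length iso) row ∷ iso
  where
  sound : ∀ {z w} → T (((x <ᵇ z) == (y <ᵇ w)) ∧ ((z <ᵇ x) == (w <ᵇ y))) → SameComparison x y z w
  sound h = let (p , q) = Equivalence.to T-∧ h in sameComparison (==⇒≡ p) (==⇒≡ q)

OrderIso⇒sameOrder : ∀ {σ s} → OrderIso σ s → T (sameOrder σ s)
OrderIso⇒sameOrder [] = _
OrderIso⇒sameOrder {x ∷ _} {y ∷ _} (cs ∷ iso) =
  Equivalence.from T-∧ (Pointwise⇒all-zip _ complete cs , OrderIso⇒sameOrder iso)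
  where
  complete : ∀ {z w} → SameComparison x y z w → T (((x <ᵇ z) == (y <ᵇ w)) ∧ ((z <ᵇ x) == (w <ᵇ y)))
  complete (sameComparison p q) = Equivalence.from T-∧ (≡⇒== p , ≡⇒== q)

∈-subseqs⁻ : ∀ {t} π → t ∈ subseqs π → t ⊆ π
∈-subseqs⁻ []       (here refl) = []
∈-subseqs⁻ (x ∷ xs) t∈ with ∈-++⁻ (map (x ∷_) (subseqs xs)) t∈
... | inj₁ t∈ˡ with ∈-map⁻ (x ∷_) t∈ˡ
...   | t′ , t′∈ , refl = refl ∷ ∈-subseqs⁻ xs t′∈
∈-subseqs⁻ (x ∷ xs) t∈ | inj₂ t∈ʳ = x ∷ʳ ∈-subseqs⁻ xs t∈ʳ

∈-subseqs⁺ : ∀ {t π} → t ⊆ π → t ∈ subseqs π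
∈-subseqs⁺ []                      = here refl
∈-subseqs⁺ {π = x ∷ xs} (.x ∷ʳ τ)  = ∈-++⁺ʳ (map (x ∷_) (subseqs xs)) (∈-subseqs⁺ τ)
∈-subseqs⁺ (refl ∷ τ)              = ∈-++⁺ˡ (∈-map⁺ _ (∈-subseqs⁺ τ))

Above : List ℕ → List ℕ → Set
Above xs ys = All (λ x → All (_< x) ys) xs

Above-resp-⊆ : ∀ {xs ys t₁ t₂} → t₁ ⊆ xs → t₂ ⊆ ys → Above xs ys → Above t₁ t₂
Above-resp-⊆ τ₁ τ₂ xs>ys = All.map (All-resp-⊆ τ₂) (All-resp-⊆ τ₁ xs>ys)

OrderIso-++⁻ : ∀ {g₁ g₂ s₁ s₂} → length g₁ ≡ length s₁ → OrderIso (g₁ ++ g₂) (s₁ ++ s₂) →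
               OrderIso g₁ s₁ × OrderIso g₂ s₂
OrderIso-++⁻ {[]}    {s₁ = []}    _   iso        = [] , iso
OrderIso-++⁻ {_ ∷ g₁} {s₁ = _ ∷ s₁} len (cs ∷ iso) =
  let (iso₁ , iso₂) = OrderIso-++⁻ (suc-injective len) iso
  in proj₁ (Pointwise-++⁻ {g₁ = g₁} {s₁ = s₁} (suc-injective len) cs) ∷ iso₁ , iso₂

OrderIso-Above⁻ : ∀ {g₁ g₂ s₁ s₂} → length g₁ ≡ length s₁ → OrderIso (g₁ ++ g₂) (s₁ ++ s₂) →
                  Above s₁ s₂ → Above g₁ g₂
OrderIso-Above⁻ {[]}     {s₁ = []}    _   _          _              = []
OrderIso-Above⁻ {_ ∷ g₁} {s₁ = _ ∷ s₁} len (cs ∷ iso) (s>s₂ ∷ s₁>s₂) =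
  Pointwise-All< (Pointwise.symmetric SameComparison-sym (proj₂ (Pointwise-++⁻ {g₁ = g₁} {s₁ = s₁} (suc-injective len) cs))) s>s₂
    ∷ OrderIso-Above⁻ (suc-injective len) iso s₁>s₂

OrderIso-++⁺ : ∀ {g₁ g₂ s₁ s₂} → OrderIso g₁ s₁ → OrderIso g₂ s₂ → Above g₁ g₂ → Above s₁ s₂ →
               OrderIso (g₁ ++ g₂) (s₁ ++ s₂)
OrderIso-++⁺ []          iso₂ _              _              = iso₂
OrderIso-++⁺ (cs ∷ iso₁) iso₂ (g>g₂ ∷ g₁>g₂) (s>s₂ ∷ s₁>s₂) =
  Pointwise.++⁺ cs (All<⇒Pointwise (OrderIso-length iso₂) g>g₂ s>s₂) ∷ OrderIso-++⁺ iso₁ iso₂ g₁>g₂ s₁>s₂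

restrict : ∀ {t g s} → t ⊆ g → OrderIso g s → List ℕ
restrict []         []                  = []
restrict (_ ∷ʳ τ)   (_ ∷ iso)           = restrict τ iso
restrict (refl ∷ τ) (_∷_ {y = y} _ iso) = y ∷ restrict τ iso

restrict-⊆ : ∀ {t g s} (τ : t ⊆ g) (iso : OrderIso g s) → restrict τ iso ⊆ s
restrict-⊆ []         []                  = []
restrict-⊆ (_ ∷ʳ τ)   (_∷_ {y = y} _ iso) = y ∷ʳ restrict-⊆ τ iso
restrict-⊆ (refl ∷ τ) (_ ∷ iso)           = refl ∷ restrict-⊆ τ iso

Pointwise-restrict : ∀ {R : ℕ → ℕ → Set} {t g s} (τ : t ⊆ g) (iso : OrderIso g s) →
                     Pointwise R g s → Pointwise R t (restrict τ iso)
Pointwise-restrict []         []        []       = []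
Pointwise-restrict (_ ∷ʳ τ)   (_ ∷ iso) (_ ∷ rs) = Pointwise-restrict τ iso rs
Pointwise-restrict (refl ∷ τ) (_ ∷ iso) (r ∷ rs) = r ∷ Pointwise-restrict τ iso rs

OrderIso-restrict : ∀ {t g s} (τ : t ⊆ g) (iso : OrderIso g s) → OrderIso t (restrict τ iso)
OrderIso-restrict []         []         = []
OrderIso-restrict (_ ∷ʳ τ)   (_ ∷ iso)  = OrderIso-restrict τ iso
OrderIso-restrict (refl ∷ τ) (cs ∷ iso) = Pointwise-restrict τ iso cs ∷ OrderIso-restrict τ iso

Contains : List ℕ → List ℕ → Set
Contains π σ = ∃[ s ] s ⊆ π × OrderIso σ s

contains⇒Contains : ∀ π σ → T (contains π σ) → Contains π σ
contains⇒Contains π σ h with find (Any.any⁻ (sameOrder σ) (subseqs π) h)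
... | s , s∈ , ok = s , ∈-subseqs⁻ π s∈ , sameOrder⇒OrderIso σ s ok

Contains⇒contains : ∀ {π σ} → Contains π σ → T (contains π σ)
Contains⇒contains {π} {σ} (s , τ , iso) = Any.any⁺ (sameOrder σ) (lose (∈-subseqs⁺ τ) (OrderIso⇒sameOrder iso))

Contains-trans : ∀ {π σ ς} → Contains π σ → Contains σ ς → Contains π ς
Contains-trans (s , s⊆π , σ≅s) (t , t⊆σ , ς≅t) =
  restrict t⊆σ σ≅s , ⊆-trans (restrict-⊆ t⊆σ σ≅s) s⊆π , OrderIso-trans ς≅t (OrderIso-restrict t⊆σ σ≅s)

⊆⇒Contains : ∀ {t π} → t ⊆ π → Contains π t
⊆⇒Contains {t} t⊆π = t , t⊆π , OrderIso-refl t

Contains-++ˡ : ∀ {σ} xs {ys} → Contains ys σ → Contains (xs ++ ys) σ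
Contains-++ˡ xs (s , s⊆ys , iso) = s , ++⁺ˡ xs s⊆ys , iso

Contains-++⁻ : ∀ {σ} p ρ → Above p ρ → Contains (p ++ ρ) σ →
               ∃[ j ] Contains p (take j σ) × Contains ρ (drop j σ) × Above (take j σ) (drop j σ)
Contains-++⁻ {σ} p ρ p>ρ (s , s⊆ , σ≅s) with ⊆-++⁻ p ρ s⊆
... | t₁ , t₂ , refl , t₁⊆p , t₂⊆ρ =
  let (iso₁ , iso₂) = OrderIso-++⁻ len-take σ≅t in
  j , (t₁ , t₁⊆p , iso₁) , (t₂ , t₂⊆ρ , iso₂) , OrderIso-Above⁻ len-take σ≅t (Above-resp-⊆ t₁⊆p t₂⊆ρ p>ρ)
  where
  j : ℕ
  j = length t₁
  σ≅t : OrderIso (take j σ ++ drop j σ) (t₁ ++ t₂)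
  σ≅t = subst (λ g → OrderIso g (t₁ ++ t₂)) (sym (take++drop≡id j σ)) σ≅s
  len-take : length (take j σ) ≡ j
  len-take = trans (length-take j σ)
    (m≤n⇒m⊓n≡m (subst (j ≤_) (sym (trans (OrderIso-length σ≅s) (length-++ t₁))) (m≤m+n j (length t₂))))

Contains-++⁺ : ∀ {p ρ g₁ g₂} → Above p ρ → Contains p g₁ → Contains ρ g₂ → Above g₁ g₂ → Contains (p ++ ρ) (g₁ ++ g₂)
Contains-++⁺ p>ρ (s₁ , s₁⊆p , iso₁) (s₂ , s₂⊆ρ , iso₂) g₁>g₂ =
  s₁ ++ s₂ , ++⁺ s₁⊆p s₂⊆ρ , OrderIso-++⁺ iso₁ iso₂ g₁>g₂ (Above-resp-⊆ s₁⊆p s₂⊆ρ p>ρ)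


Decreasing : List ℕ → Set
Decreasing = AllPairs (λ x y → y < x)

Decreasing-OrderIso : ∀ {g s} → OrderIso g s → Decreasing g → Decreasing s
Decreasing-OrderIso []         []          = []
Decreasing-OrderIso (cs ∷ iso) (x>g ∷ dec) = Pointwise-All< cs x>g ∷ Decreasing-OrderIso iso dec

Decreasing⇒OrderIso : ∀ {g s} → length g ≡ length s → Decreasing g → Decreasing s → OrderIso g s
Decreasing⇒OrderIso {[]}    {[]}    _   []          []          = []
Decreasing⇒OrderIso {_ ∷ _} {_ ∷ _} len (x>g ∷ dg) (y>s ∷ ds) =
  All<⇒Pointwise (suc-injective len) x>g y>s ∷ Decreasing⇒OrderIso (suc-injective len) dg ds

Decreasing⇒Unique : ∀ {xs} → Decreasing xs → Unique xs
Decreasing⇒Unique = AllPairs.map (λ y<x x≡y → <-irrefl (sym x≡y) y<x)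

pairs⇒Decreasing : ∀ τ → (∀ {x y} → x ∷ y ∷ [] ⊆ τ → y < x) → Decreasing τ
pairs⇒Decreasing []      _     = []
pairs⇒Decreasing (t ∷ τ) pairs = All.tabulate (λ y∈ → pairs (refl ∷ from∈ y∈)) ∷ pairs⇒Decreasing τ (pairs ∘ (t ∷ʳ_))

length-descRange : ∀ s l → length (descRange s l) ≡ l
length-descRange s zero    = refl
length-descRange s (suc l) = cong suc (length-descRange (s ∸ 1) l)

descRange-≤ : ∀ {x} s l → x ∈ descRange s l → x ≤ s
descRange-≤ s (suc l) (here refl) = ≤-refl
descRange-≤ s (suc l) (there x∈)  = ≤-trans (descRange-≤ (s ∸ 1) l x∈) (m∸n≤m s 1)

descRange-> : ∀ {x} s l → l ≤ s → x ∈ descRange s l → s ∸ l < x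
descRange-> (suc s) (suc l) (s≤s l≤s) (here refl) = s≤s (m∸n≤m s l)
descRange-> (suc s) (suc l) (s≤s l≤s) (there x∈)  = descRange-> s l l≤s x∈

descRange-decreasing : ∀ s l → l ≤ s → Decreasing (descRange s l)
descRange-decreasing s       zero    _         = []
descRange-decreasing (suc s) (suc l) (s≤s l≤s) =
  All.tabulate (λ x∈ → s≤s (descRange-≤ s l x∈)) ∷ descRange-decreasing s l l≤s

take-descRange : ∀ s {j k} → j ≤ k → take j (descRange s k) ≡ descRange s j
take-descRange s {zero}          _         = refl
take-descRange s {suc j} {suc k} (s≤s j≤k) = cong (s ∷_) (take-descRange (s ∸ 1) j≤k)

⊆-++-[x]-head : ∀ {D N v t} → All (_< v) D → (v ∷ t) ⊆ D ++ [ N ] → v ≡ N × t ≡ []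
⊆-++-[x]-head []          (refl ∷ [])  = refl , refl
⊆-++-[x]-head (d<v ∷ D<v) (_ ∷ʳ τ)     = ⊆-++-[x]-head D<v τ
⊆-++-[x]-head (d<v ∷ D<v) (refl ∷ τ)   = ⊥-elim (<-irrefl refl d<v)

ascent-⊆-++-[x] : ∀ {D N u v t} → Decreasing D → (u ∷ v ∷ t) ⊆ D ++ [ N ] → u < v → v ≡ N × t ≡ []
ascent-⊆-++-[x] {[]}    _           (_ ∷ʳ ())
ascent-⊆-++-[x] {[]}    _           (refl ∷ ())
ascent-⊆-++-[x] {_ ∷ _} (_ ∷ decD)  (_ ∷ʳ τ)   u<v = ascent-⊆-++-[x] decD τ u<v
ascent-⊆-++-[x] {_ ∷ _} (u>D ∷ _)   (refl ∷ τ) u<v =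
  ⊆-++-[x]-head (All.map (λ x<u → <-trans x<u u<v) u>D) τ

n≤1+[n∸1] : ∀ n → n ≤ suc (n ∸ 1)
n≤1+[n∸1] zero    = z≤n
n≤1+[n∸1] (suc n) = ≤-refl

length-Decreasing-⊆-++-[x] : ∀ {D N s} → All (_< N) D → Decreasing s → s ⊆ D ++ [ N ] → length s ≤ suc (length D ∸ 1)
length-Decreasing-⊆-++-[x] {D} {N} D<N decS τ with ⊆-++⁻ D [ N ] τ
... | t₁ , t₂ , refl , t₁⊆D , t₂⊆N with ⊆-[x] t₂⊆N
...   | inj₁ refl rewrite ++-identityʳ t₁ = ≤-trans (length-mono-≤ t₁⊆D) (n≤1+[n∸1] (length D))
...   | inj₂ refl with t₁ | decS
...     | []    | _          = s≤s z≤n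
...     | x ∷ t | x>t ∷ _    = ⊥-elim (<-asym (All.head (All-resp-⊆ t₁⊆D D<N)) (All.lookup x>t (∈-++⁺ʳ t (here refl))))

topRun : ℕ → ℕ → List ℕ
topRun n k = descRange (n ∸ 1) k ++ [ n ]

length-topRun : ∀ n k → length (topRun n k) ≡ suc k
length-topRun n k = trans (length-++ (descRange (n ∸ 1) k)) (trans (cong (_+ 1) (length-descRange (n ∸ 1) k)) (+-comm k 1))

descRange<1+ : ∀ {x} n k → x ∈ descRange n k → x < suc n
descRange<1+ n k x∈ = s≤s (descRange-≤ n k x∈)

topRun-≤ : ∀ {x} n k → x ∈ topRun (suc n) k → x ≤ suc n
topRun-≤ n k x∈ with ∈-++⁻ (descRange n k) x∈
... | inj₁ x∈D          = <⇒≤ (descRange<1+ n k x∈D)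
... | inj₂ (here refl)  = ≤-refl

topRun-> : ∀ {x} n k → k ≤ n → x ∈ topRun (suc n) k → n ∸ k < x
topRun-> n k k≤n x∈ with ∈-++⁻ (descRange n k) x∈
... | inj₁ x∈D         = descRange-> n k k≤n x∈D
... | inj₂ (here refl) = s≤s (m∸n≤m n k)

topRun-Above : ∀ {ρ} n k → k ≤ n → All (_≤ n ∸ k) ρ → Above (topRun (suc n) k) ρ
topRun-Above n k k≤n ρ≤ = All.tabulate λ x∈ → All.map (λ y≤ → <-≤-trans (s≤s y≤) (topRun-> n k k≤n x∈)) ρ≤

topRun-Unique : ∀ n k → k ≤ n → Unique (topRun (suc n) k)
topRun-Unique n k k≤n = Unique.++⁺ (Decreasing⇒Unique (descRange-decreasing n k k≤n)) ([] ∷ [])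
  λ { (x∈D , here refl) → <-irrefl refl (descRange<1+ n k x∈D) }

-- suc (k ∸ 1) = max 1 k: a longest decreasing subsequence of topRun is its first run, or its last entry if k = 0.
length-Decreasing-in-topRun : ∀ {g} n k → k ≤ n → Decreasing g → Contains (topRun (suc n) k) g → length g ≤ suc (k ∸ 1)
length-Decreasing-in-topRun {g} n k k≤n decG (s , s⊆ , g≅s) =
  subst₂ (λ l m → l ≤ suc (m ∸ 1)) (sym (OrderIso-length g≅s)) (length-descRange n k)
    (length-Decreasing-⊆-++-[x] (All.tabulate (descRange<1+ n k)) (Decreasing-OrderIso g≅s decG) s⊆)

Decreasing⇒Contains-topRun : ∀ {g} n k → k ≤ n → Decreasing g → length g ≤ suc (k ∸ 1) → Contains (topRun (suc n) k) g
Decreasing⇒Contains-topRun {[]}        n k       _   _    _   = [] , minimum _ , []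
Decreasing⇒Contains-topRun {_ ∷ []}    n zero    _   _    _   = [ suc n ] , refl ∷ [] , [] ∷ []
Decreasing⇒Contains-topRun {_ ∷ _ ∷ _} n zero    _   _    (s≤s ())
Decreasing⇒Contains-topRun {g@(_ ∷ _)} n (suc k) k≤n decG len =
  descRange n (length g) , ++⁺ʳ [ suc n ] run⊆ ,
  Decreasing⇒OrderIso (sym (length-descRange n (length g))) decG (descRange-decreasing n (length g) (≤-trans len k≤n))
  where
  run⊆ : descRange n (length g) ⊆ descRange n (suc k)
  run⊆ = subst (_⊆ descRange n (suc k)) (take-descRange n len) (take-⊆ (length g) (descRange n (suc k)))

ascent-topRun : ∀ {u v t} n k → k ≤ n → (u ∷ v ∷ t) ⊆ topRun (suc n) k → u < v → v ≡ suc n × t ≡ []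
ascent-topRun n k k≤n = ascent-⊆-++-[x] (descRange-decreasing n k k≤n)

topRun-no-early-ascent : ∀ {x y z σ} n k → k ≤ n → x < y → ¬ Contains (topRun (suc n) k) (x ∷ y ∷ z ∷ σ)
topRun-no-early-ascent n k k≤n x<y (u ∷ v ∷ w ∷ s , τ , (c ∷ _) ∷ _)
  with ascent-topRun n k k≤n τ (SameComparison⇒< c x<y)
... | _ , ()

topRun-avoids-312 : ∀ {x y z} n k → k ≤ n → y < z → z < x → ¬ Contains (topRun (suc n) k) (x ∷ y ∷ z ∷ [])
topRun-avoids-312 n k k≤n y<z z<x (u ∷ v ∷ w ∷ [] , τ , (_ ∷ c ∷ []) ∷ (d ∷ []) ∷ _) =
  <-irrefl w≡1+n (<-≤-trans (SameComparison⇒> c z<x) (topRun-≤ n k (Any-resp-⊆ τ (here refl))))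
  where
  w≡1+n : w ≡ suc n
  w≡1+n = proj₁ (ascent-topRun n k k≤n (∷ˡ⁻ τ) (SameComparison⇒< d y<z))

Contains-topRun++-low-first⁻ : ∀ {x y z ρ} n k → k ≤ n → All (_≤ n ∸ k) ρ → x < y → x < z →
                              Contains (topRun (suc n) k ++ ρ) (x ∷ y ∷ z ∷ []) → Contains ρ (x ∷ y ∷ z ∷ [])
Contains-topRun++-low-first⁻ {ρ = ρ} n k k≤n ρ≤ x<y x<z c with Contains-++⁻ (topRun (suc n) k) ρ (topRun-Above n k k≤n ρ≤) c
... | zero                , _  , c₂ , _                  = c₂
... | suc zero            , _  , _  , (y<x ∷ _) ∷ _      = ⊥-elim (<-asym x<y y<x)
... | suc (suc zero)      , _  , _  , (z<x ∷ []) ∷ _     = ⊥-elim (<-asym x<z z<x)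
... | suc (suc (suc _))   , c₁ , _  , _                  = ⊥-elim (topRun-no-early-ascent n k k≤n x<y c₁)


-- The pattern γ

take-γ : ∀ a b c {j} → j ≤ a → take j (γ a b c) ≡ descRange (a + b + c + 1) j
take-γ a       b c {zero}  _         = refl
take-γ (suc a) b c {suc j} (s≤s j≤a) = cong (suc a + b + c + 1 ∷_) (take-γ a b c j≤a)

drop-γ : ∀ a b c {j} → j ≤ a → drop j (γ a b c) ≡ γ (a ∸ j) b c
drop-γ a       b c {zero}  _         = refl
drop-γ (suc a) b c {suc j} (s≤s j≤a) = drop-γ a b c j≤a

γ-⊆ : ∀ {a′ a} b c → a′ ≤ a → γ a′ b c ⊆ γ a b c
γ-⊆ {a′} {a} b c a′≤a = subst (_⊆ γ a b c) (trans (drop-γ a b c (m∸n≤m a a′)) (cong (λ t → γ t b c) (m∸[m∸n]≡n a′≤a)))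
  (drop-⊆ (a ∸ a′) (γ a b c))

γ-≤ : ∀ {x} a b c → x ∈ γ a b c → x ≤ a + b + c + 1
γ-≤ (suc a) b c (here refl) = ≤-refl
γ-≤ (suc a) b c (there x∈)  = m≤n⇒m≤1+n (γ-≤ a b c x∈)
γ-≤ zero    b c x∈ with ∈-++⁻ (descRange (b + c) b) x∈
... | inj₁ x∈B          = ≤-trans (descRange-≤ (b + c) b x∈B) (m≤m+n (b + c) 1)
... | inj₂ (here refl)  = ≤-refl
... | inj₂ (there x∈C)  = ≤-trans (descRange-≤ c c x∈C) (≤-trans (m≤n+m c b) (m≤m+n (b + c) 1))

a≤a+b+c+1 : ∀ a b c → a ≤ a + b + c + 1
a≤a+b+c+1 a b c = ≤-trans (m≤m+n a b) (≤-trans (m≤m+n (a + b) c) (m≤m+n (a + b + c) 1))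

descRange-Above-γ : ∀ a b c {j} → j ≤ a → Above (descRange (a + b + c + 1) j) (γ (a ∸ j) b c)
descRange-Above-γ a b c {j} j≤a = All.tabulate λ {x} x∈ → All.tabulate λ y∈ →
  <-≤-trans (s≤s (γ-≤ (a ∸ j) b c y∈)) (subst (_< x) (top∸j a j≤a) (descRange-> (a + b + c + 1) j j≤top x∈))
  where
  j≤top : j ≤ a + b + c + 1
  j≤top = ≤-trans j≤a (a≤a+b+c+1 a b c)
  top∸j : ∀ a {j} → j ≤ a → a + b + c + 1 ∸ j ≡ a ∸ j + b + c + 1
  top∸j a       {zero}  _         = refl
  top∸j (suc a) {suc j} (s≤s j≤a) = top∸j a j≤a

-- If the cut passes the first run of γ it lies inside the run B = b + c, …, c + 1, separating b + c
-- from the larger b + c + 1, or beyond b + c + 1, so that the prefix contains the 312 (top, b + c, b + c + 1).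
γ-cut-beyond-top : ∀ {a b c n k j} → 1 ≤ a → 1 ≤ b → k ≤ n → a < j →
                   Contains (topRun (suc n) k) (take j (γ a b c)) → ¬ Above (take j (γ a b c)) (drop j (γ a b c))
γ-cut-beyond-top {suc a} {suc b} {c} {n} {k} {j} _ _ k≤n a<j c₁ cut = cutInsideB? (j ≤? suc a + suc b)
  where
  top y : ℕ
  top = suc a + suc b + c + 1
  y = suc b + c + 1
  D B C : List ℕ
  D = descRange top (suc a)
  B = descRange (suc b + c) (suc b)
  C = descRange c c
  γ≡ : γ (suc a) (suc b) c ≡ (D ++ B) ++ y ∷ C
  γ≡ = sym (++-assoc D B (y ∷ C))
  |D++B| : length (D ++ B) ≡ suc a + suc b
  |D++B| = trans (length-++ D) (cong₂ _+_ (length-descRange top (suc a)) (length-descRange (suc b + c) (suc b)))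
  bc∈take : suc b + c ∈ take j (γ (suc a) (suc b) c)
  bc∈take = Any-resp-⊆ (++-[y]-⊆-take D (subst (_< j) (sym (length-descRange top (suc a))) a<j)) (∈-++⁺ʳ D (here refl))
  bc<y : suc b + c < y
  bc<y = m<m+n (suc b + c) (s≤s z≤n)
  cutInsideB? : Dec (j ≤ suc a + suc b) → ⊥
  cutInsideB? (yes j≤a+b) = <-asym bc<y (All.lookup (All.lookup cut bc∈take) y∈drop)
    where
    y∈drop : y ∈ drop j (γ (suc a) (suc b) c)
    y∈drop = subst (λ g → y ∈ drop j g) (sym γ≡) (∈-drop-++-∷ (D ++ B) (subst (j ≤_) (sym |D++B|) j≤a+b))
  cutInsideB? (no j≰a+b) = topRun-avoids-312 n k k≤n bc<y y<top (Contains-trans c₁ (⊆⇒Contains 312⊆take))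
    where
    y<top : y < top
    y<top = +-monoˡ-< 1 (+-monoˡ-< c (s≤s (m≤n+m (suc b) a)))
    312⊆ : top ∷ suc b + c ∷ y ∷ [] ⊆ (D ++ B) ++ [ y ]
    312⊆ = refl ∷ subst (suc b + c ∷ y ∷ [] ⊆_) (sym (++-assoc (descRange (a + suc b + c + 1) a) B [ y ]))
                      (++⁺ˡ (descRange (a + suc b + c + 1) a) (refl ∷ ++⁺ˡ (descRange (b + c) b) (refl ∷ [])))
    312⊆take : top ∷ suc b + c ∷ y ∷ [] ⊆ take j (γ (suc a) (suc b) c)
    312⊆take = ⊆-trans 312⊆ (subst (λ g → (D ++ B) ++ [ y ] ⊆ take j g) (sym γ≡)
                 (++-[y]-⊆-take (D ++ B) (subst (_< j) (sym |D++B|) (≰⇒> j≰a+b))))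

Contains-topRun++-γ⁻ : ∀ {a b c n k ρ} → 1 ≤ a → 1 ≤ b → k ≤ n → All (_≤ n ∸ k) ρ →
                       Contains (topRun (suc n) k ++ ρ) (γ a b c) → Contains ρ (γ (a ∸ suc (k ∸ 1)) b c)
Contains-topRun++-γ⁻ {a} {b} {c} {n} {k} {ρ} 1≤a 1≤b k≤n ρ≤ cont
  with Contains-++⁻ (topRun (suc n) k) ρ (topRun-Above n k k≤n ρ≤) cont
... | j , c₁ , c₂ , cut with j ≤? a
...   | no  j≰a = ⊥-elim (γ-cut-beyond-top 1≤a 1≤b k≤n (≰⇒> j≰a) c₁ cut)
...   | yes j≤a = Contains-trans (subst (Contains ρ) (drop-γ a b c j≤a) c₂) (⊆⇒Contains (γ-⊆ b c (∸-monoʳ-≤ a j≤m)))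
  where
  j≤m : j ≤ suc (k ∸ 1)
  j≤m = subst (_≤ suc (k ∸ 1)) (length-descRange (a + b + c + 1) j)
          (length-Decreasing-in-topRun n k k≤n (descRange-decreasing (a + b + c + 1) j (≤-trans j≤a (a≤a+b+c+1 a b c)))
            (subst (Contains (topRun (suc n) k)) (take-γ a b c j≤a) c₁))

Contains-topRun++-γ⁺ : ∀ {a b c n k ρ} → k ≤ n → All (_≤ n ∸ k) ρ →
                       Contains ρ (γ (a ∸ suc (k ∸ 1)) b c) → Contains (topRun (suc n) k ++ ρ) (γ a b c)
Contains-topRun++-γ⁺ {a} {b} {c} {n} {k} {ρ} k≤n ρ≤ cont =
  subst (Contains (topRun (suc n) k ++ ρ)) γ≡
    (Contains-++⁺ (topRun-Above n k k≤n ρ≤)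
       (Decreasing⇒Contains-topRun n k k≤n (descRange-decreasing (a + b + c + 1) j (≤-trans j≤a (a≤a+b+c+1 a b c)))
          (subst (_≤ suc (k ∸ 1)) (sym (length-descRange (a + b + c + 1) j)) (m⊓n≤n a (suc (k ∸ 1)))))
       (subst (λ t → Contains ρ (γ t b c)) (sym a∸j≡a∸m) cont)
       (descRange-Above-γ a b c j≤a))
  where
  j : ℕ
  j = a ⊓ suc (k ∸ 1)
  j≤a : j ≤ a
  j≤a = m⊓n≤m a (suc (k ∸ 1))
  γ≡ : descRange (a + b + c + 1) j ++ γ (a ∸ j) b c ≡ γ a b c
  γ≡ = trans (cong₂ _++_ (sym (take-γ a b c j≤a)) (sym (drop-γ a b c j≤a))) (take++drop≡id j (γ a b c))
  a∸j≡a∸m : a ∸ j ≡ a ∸ suc (k ∸ 1)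
  a∸j≡a∸m = trans (∸-distribˡ-⊓-⊔ a a (suc (k ∸ 1))) (cong (_⊔ (a ∸ suc (k ∸ 1))) (n∸n≡0 a))


-- Permutations

InRange : ℕ → ℕ → Set
InRange n x = 1 ≤ x × x ≤ n

record IsPerm (n : ℕ) (π : List ℕ) : Set where
  field
    unique  : Unique π
    length≡ : length π ≡ n
    bounded : All (InRange n) π

∈-applyUpTo-suc⁻ : ∀ {n x} → x ∈ applyUpTo suc n → InRange n x
∈-applyUpTo-suc⁻ x∈ with ∈-applyUpTo⁻ suc x∈
... | _ , i<n , refl = s≤s z≤n , i<n

∈-applyUpTo-suc⁺ : ∀ {n x} → InRange n x → x ∈ applyUpTo suc n
∈-applyUpTo-suc⁺ {x = suc x} (_ , x<n) = ∈-applyUpTo⁺ suc x<n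

∈-words⁻ : ∀ n l {w} → w ∈ words n l → length w ≡ l × All (InRange n) w
∈-words⁻ n zero    (here refl) = refl , []
∈-words⁻ n (suc l) w∈ with find (∈-concatMap⁻ (λ x → map (x ∷_) (words n l)) {xs = applyUpTo suc n} w∈)
... | x , x∈ , w∈x∷ with ∈-map⁻ (x ∷_) w∈x∷
...   | v , v∈ , refl = let (len , inRange) = ∈-words⁻ n l v∈ in cong suc len , ∈-applyUpTo-suc⁻ x∈ ∷ inRange

∈-words⁺ : ∀ n l {w} → length w ≡ l → All (InRange n) w → w ∈ words n l
∈-words⁺ n zero    {[]}    _   []              = here refl
∈-words⁺ n (suc l) {x ∷ w} len (x∈ ∷ inRange) =
  ∈-concatMap⁺ (λ x → map (x ∷_) (words n l)) (lose (∈-applyUpTo-suc⁺ x∈) (∈-map⁺ (x ∷_) (∈-words⁺ n l (suc-injective len) inRange)))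

concatMap-∷-Unique : ∀ (W : List (List ℕ)) xs → Unique xs → Unique W → Unique (concatMap (λ x → map (x ∷_) W) xs)
concatMap-∷-Unique W []       _           _       = []
concatMap-∷-Unique W (x ∷ xs) (x∉xs ∷ ux) uniqueW =
  Unique.++⁺ (Unique.map⁺ ∷-injectiveʳ uniqueW) (concatMap-∷-Unique W xs ux uniqueW) disjoint
  where
  disjoint : ∀ {v} → ¬ (v ∈ map (x ∷_) W × v ∈ concatMap (λ x → map (x ∷_) W) xs)
  disjoint (v∈ˡ , v∈ʳ) with ∈-map⁻ (x ∷_) v∈ˡ | find (∈-concatMap⁻ (λ x → map (x ∷_) W) {xs = xs} v∈ʳ)
  ... | _ , _ , refl | x′ , x′∈ , v∈x′ with ∈-map⁻ (x′ ∷_) v∈x′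
  ...   | _ , _ , eq = All.lookup x∉xs x′∈ (∷-injectiveˡ eq)

words-Unique : ∀ n l → Unique (words n l)
words-Unique n zero    = [] ∷ []
words-Unique n (suc l) =
  concatMap-∷-Unique (words n l) (applyUpTo suc n) (Unique.applyUpTo⁺₁ suc n (λ i<j _ → <⇒≢ (s≤s i<j))) (words-Unique n l)

distinct⇒Unique : ∀ xs → T (distinct xs) → Unique xs
distinct⇒Unique []       _ = []
distinct⇒Unique (x ∷ xs) t =
  let (fresh , rest) = Equivalence.to T-∧ t
  in All.map T-not-≡ᵇ⇒≢ (All.all⁺ _ xs fresh) ∷ distinct⇒Unique xs rest

Unique⇒distinct : ∀ {xs} → Unique xs → T (distinct xs)
Unique⇒distinct []            = _
Unique⇒distinct (fresh ∷ uxs) = Equivalence.from T-∧ (All.all⁻ _ (All.map ≢⇒T-not-≡ᵇ fresh) , Unique⇒distinct uxs)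

∈-perms⁻ : ∀ n {π} → π ∈ perms n → IsPerm n π
∈-perms⁻ n π∈ =
  let (π∈words , d) = ∈-filter⁻ (T? ∘ distinct) π∈
      (len , inRange) = ∈-words⁻ n n π∈words
  in record { unique = distinct⇒Unique _ d ; length≡ = len ; bounded = inRange }

∈-perms⁺ : ∀ n {π} → IsPerm n π → π ∈ perms n
∈-perms⁺ n p = ∈-filter⁺ (T? ∘ distinct) (∈-words⁺ n n (IsPerm.length≡ p) (IsPerm.bounded p)) (Unique⇒distinct (IsPerm.unique p))

perms-Unique : ∀ n → Unique (perms n)
perms-Unique n = Unique.filter⁺ (T? ∘ distinct) (words-Unique n n)

IsPerm-∈ : ∀ {n π v} → IsPerm n π → InRange n v → v ∈ π
IsPerm-∈ {n} {π} {v} p v∈[1,n] with v ∈? π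
... | yes v∈π = v∈π
... | no  v∉π with ∈-∃++ (∈-applyUpTo-suc⁺ v∈[1,n])
...   | us , ws , [1,n]≡ = ⊥-elim (<-irrefl refl (subst (_≤ length (us ++ ws)) n≡ π-short))
  where
  π⊆us++ws : ∀ {x} → x ∈ π → x ∈ us ++ ws
  π⊆us++ws x∈ = ∈-++-∷⁻ us (subst (_ ∈_) [1,n]≡ (∈-applyUpTo-suc⁺ (All.lookup (IsPerm.bounded p) x∈)))
                            (λ x≡v → v∉π (subst (_∈ π) x≡v x∈))
  π-short : length π ≤ length (us ++ ws)
  π-short = Unique-length-≤ (us ++ ws) (IsPerm.unique p) π⊆us++ws
  n≡ : length π ≡ suc (length (us ++ ws))
  n≡ = trans (IsPerm.length≡ p) (trans (sym (length-applyUpTo suc n)) (trans (cong length [1,n]≡) (length-++-∷ us)))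

IsPerm-remove-max : ∀ {n} τ {ρ} → IsPerm (suc n) (τ ++ suc n ∷ ρ) → IsPerm n (τ ++ ρ)
IsPerm-remove-max {n} τ {ρ} p = record
  { unique  = AllPairs-resp-⊆ τρ⊆π (IsPerm.unique p)
  ; length≡ = suc-injective (trans (sym (length-++-∷ τ)) (IsPerm.length≡ p))
  ; bounded = All.tabulate λ {x} x∈ →
      let (1≤x , x≤1+n) = All.lookup (IsPerm.bounded p) (Any-resp-⊆ τρ⊆π x∈)
      in 1≤x , ≤-pred (≤∧≢⇒< x≤1+n (λ { refl → Unique-++-∷⁻ τ (IsPerm.unique p) x∈ }))
  }
  where
  τρ⊆π : τ ++ ρ ⊆ τ ++ suc n ∷ ρ
  τρ⊆π = ++⁺ ⊆-refl (suc n ∷ʳ ⊆-refl)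

decreasing-top-shape : ∀ n τ {ρ} → IsPerm n (τ ++ ρ) → Decreasing τ → Above τ ρ →
                       τ ≡ descRange n (length τ) × All (_≤ n ∸ length τ) ρ
decreasing-top-shape n       []      p _ _ = refl , All.map proj₂ (IsPerm.bounded p)
decreasing-top-shape zero    (t ∷ τ) p _ _ with All.head (IsPerm.bounded p)
... | 1≤t , t≤0 = ⊥-elim (<-irrefl refl (≤-trans 1≤t t≤0))
decreasing-top-shape (suc n) (t ∷ τ) {ρ} p (t>τ ∷ decτ) (t>ρ ∷ τ>ρ) =
  let (τ≡ , ρ≤) = decreasing-top-shape n τ (IsPerm-remove-max [] (subst (λ x → IsPerm (suc n) (x ∷ τ ++ ρ)) t≡1+n p)) decτ τ>ρ
  in cong₂ _∷_ t≡1+n τ≡ , ρ≤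
  where
  t≡1+n : t ≡ suc n
  t≡1+n with IsPerm-∈ p (s≤s z≤n , ≤-refl)
  ... | here 1+n≡t  = sym 1+n≡t
  ... | there 1+n∈ = ⊥-elim (<-irrefl refl (<-≤-trans 1+n<t (proj₂ (All.head (IsPerm.bounded p)))))
    where
    1+n<t : suc n < t
    1+n<t = [ All.lookup t>τ , All.lookup t>ρ ]′ (∈-++⁻ τ 1+n∈)

OrderIso-123 : ∀ {x y z} → x < y → y < z → OrderIso p123 (x ∷ y ∷ z ∷ [])
OrderIso-123 x<y y<z =
  (<⇒SameComparison (s≤s (s≤s z≤n)) x<y ∷ <⇒SameComparison (s≤s (s≤s z≤n)) (<-trans x<y y<z) ∷ [])
  ∷ (<⇒SameComparison (s≤s (s≤s (s≤s z≤n))) y<z ∷ []) ∷ [] ∷ []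

OrderIso-132 : ∀ {x y z} → x < z → z < y → OrderIso p132 (x ∷ y ∷ z ∷ [])
OrderIso-132 x<z z<y =
  (<⇒SameComparison (s≤s (s≤s z≤n)) (<-trans x<z z<y) ∷ <⇒SameComparison (s≤s (s≤s z≤n)) x<z ∷ [])
  ∷ (>⇒SameComparison (s≤s (s≤s (s≤s z≤n))) z<y ∷ []) ∷ [] ∷ []

≢∧≮⇒> : ∀ {x y} → x ≢ y → ¬ x < y → y < x
≢∧≮⇒> x≢y x≮y = ≤∧≢⇒< (≮⇒≥ x≮y) (x≢y ∘ sym)

-- An ascent before the maximum n + 1 would extend to a 123, and an entry before it below one after it
-- would give a 132 with the maximum in the middle.
avoider-shape : ∀ n {π} → IsPerm (suc n) π → ¬ Contains π p123 → ¬ Contains π p132 →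
                ∃₂ λ k ρ → k ≤ n × π ≡ topRun (suc n) k ++ ρ × IsPerm (n ∸ k) ρ
avoider-shape n {π} p no123 no132 with ∈-∃++ (IsPerm-∈ p (s≤s z≤n , ≤-refl))
... | τ , ρ , refl = length τ , ρ , k≤n , π≡ , ρ-perm
  where
  p′ : IsPerm n (τ ++ ρ)
  p′ = IsPerm-remove-max τ p
  below-max : ∀ {x} → x ∈ τ ++ ρ → x < suc n
  below-max x∈ = s≤s (proj₂ (All.lookup (IsPerm.bounded p′) x∈))
  distinct-pair : ∀ {x y} → x ∷ y ∷ [] ⊆ π → x ≢ y
  distinct-pair xy⊆ = All.head (AllPairs.head (AllPairs-resp-⊆ xy⊆ (IsPerm.unique p)))
  decτ : Decreasing τ
  decτ = pairs⇒Decreasing τ λ {x} {y} xy⊆τ →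
    let xyn⊆π = ++⁺ xy⊆τ (refl ∷ minimum ρ)
    in ≢∧≮⇒> (distinct-pair (⊆-trans (refl ∷ refl ∷ minimum _) xyn⊆π))
             (λ x<y → no123 (_ , xyn⊆π , OrderIso-123 x<y (below-max (∈-++⁺ˡ (Any-resp-⊆ xy⊆τ (there (here refl)))))))
  τ>ρ : Above τ ρ
  τ>ρ = All.tabulate λ {x} x∈τ → All.tabulate λ {y} y∈ρ →
    ≢∧≮⇒> (distinct-pair (++⁺ (from∈ x∈τ) (suc n ∷ʳ from∈ y∈ρ)))
          (λ x<y → no132 (_ , ++⁺ (from∈ x∈τ) (refl ∷ from∈ y∈ρ) , OrderIso-132 x<y (below-max (∈-++⁺ʳ τ y∈ρ))))
  shape : τ ≡ descRange n (length τ) × All (_≤ n ∸ length τ) ρ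
  shape = decreasing-top-shape n τ p′ decτ τ>ρ
  |τ|+|ρ| : length τ + length ρ ≡ n
  |τ|+|ρ| = trans (sym (length-++ τ)) (IsPerm.length≡ p′)
  k≤n : length τ ≤ n
  k≤n = subst (length τ ≤_) |τ|+|ρ| (m≤m+n (length τ) (length ρ))
  π≡ : τ ++ suc n ∷ ρ ≡ topRun (suc n) (length τ) ++ ρ
  π≡ = trans (cong (_++ suc n ∷ ρ) (proj₁ shape)) (sym (++-assoc (descRange n (length τ)) [ suc n ] ρ))
  ρ-perm : IsPerm (n ∸ length τ) ρ
  ρ-perm = record
    { unique  = AllPairs-resp-⊆ (++⁺ˡ τ (suc n ∷ʳ ⊆-refl)) (IsPerm.unique p)
    ; length≡ = sym (trans (cong (_∸ length τ) (sym |τ|+|ρ|)) (m+n∸m≡n (length τ) (length ρ)))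
    ; bounded = All.tabulate λ y∈ → proj₁ (All.lookup (IsPerm.bounded p′) (∈-++⁺ʳ τ y∈)) , All.lookup (proj₂ shape) y∈
    }

topRun++-IsPerm : ∀ {n k ρ} → k ≤ n → IsPerm (n ∸ k) ρ → IsPerm (suc n) (topRun (suc n) k ++ ρ)
topRun++-IsPerm {n} {k} {ρ} k≤n p = record
  { unique  = Unique.++⁺ (topRun-Unique n k k≤n) (IsPerm.unique p)
                λ (x∈top , x∈ρ) → <-irrefl refl (All.lookup (All.lookup top>ρ x∈top) x∈ρ)
  ; length≡ = trans (length-++ (topRun (suc n) k))
                (trans (cong₂ _+_ (length-topRun (suc n) k) (IsPerm.length≡ p)) (cong suc (m+[n∸m]≡n k≤n)))
  ; bounded = All.++⁺ (All.tabulate λ x∈ → <-≤-trans (s≤s z≤n) (topRun-> n k k≤n x∈) , topRun-≤ n k x∈)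
                      (All.map (λ (1≤y , y≤) → 1≤y , m≤n⇒m≤1+n (≤-trans y≤ (m∸n≤m n k))) (IsPerm.bounded p))
  }
  where
  top>ρ : Above (topRun (suc n) k) ρ
  top>ρ = topRun-Above n k k≤n (All.map proj₂ (IsPerm.bounded p))


Avoids : List ℕ → List (List ℕ) → Set
Avoids π R = All (¬_ ∘ Contains π) R

avoiders : List (List ℕ) → ℕ → List (List ℕ)
avoiders R n = filterᵇ (λ π → avoidsAll π R) (perms n)

avoids⇒¬Contains : ∀ π σ → T (avoids π σ) → ¬ Contains π σ
avoids⇒¬Contains π σ t c with contains π σ | Contains⇒contains c
... | true  | _  = t
... | false | ()

¬Contains⇒avoids : ∀ π σ → ¬ Contains π σ → T (avoids π σ)
¬Contains⇒avoids π σ ¬c with contains π σ in eq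
... | true  = ¬c (contains⇒Contains π σ (subst T (sym eq) _))
... | false = _

∈-avoiders⁻ : ∀ R n {π} → π ∈ avoiders R n → IsPerm n π × Avoids π R
∈-avoiders⁻ R n {π} π∈ =
  let (π∈perms , t) = ∈-filter⁻ (T? ∘ λ π → avoidsAll π R) π∈
  in ∈-perms⁻ n π∈perms , All.map (avoids⇒¬Contains π _) (All.all⁺ _ R t)

∈-avoiders⁺ : ∀ R n {π} → IsPerm n π → Avoids π R → π ∈ avoiders R n
∈-avoiders⁺ R n {π} p av =
  ∈-filter⁺ (T? ∘ λ π → avoidsAll π R) (∈-perms⁺ n p) (All.all⁻ _ (All.map (¬Contains⇒avoids π _) av))

avoiders-Unique : ∀ R n → Unique (avoiders R n)
avoiders-Unique R n = Unique.filter⁺ _ (perms-Unique n)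


sum-applyUpTo-cong : ∀ {g h : ℕ → ℕ} l → (∀ {i} → i < l → g i ≡ h i) → sum (applyUpTo g l) ≡ sum (applyUpTo h l)
sum-applyUpTo-cong zero    _   = refl
sum-applyUpTo-cong (suc l) g≡h = cong₂ _+_ (g≡h (s≤s z≤n)) (sum-applyUpTo-cong l (g≡h ∘ s≤s))

sum-applyUpTo-zero : ∀ {g : ℕ → ℕ} l → (∀ {i} → i < l → g i ≡ 0) → sum (applyUpTo g l) ≡ 0
sum-applyUpTo-zero zero    _   = refl
sum-applyUpTo-zero (suc l) g≡0 = cong₂ _+_ (g≡0 (s≤s z≤n)) (sum-applyUpTo-zero l (g≡0 ∘ s≤s))

sum-applyUpTo-extend : ∀ {g : ℕ → ℕ} {n l} → (∀ {i} → n ≤ i → g i ≡ 0) → n ≤ l →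
                       sum (applyUpTo g n) ≡ sum (applyUpTo g l)
sum-applyUpTo-extend {l = l} g≡0 z≤n         = sym (sum-applyUpTo-zero l (λ _ → g≡0 z≤n))
sum-applyUpTo-extend {g}     g≡0 (s≤s n≤l)   = cong (g 0 +_) (sum-applyUpTo-extend (g≡0 ∘ s≤s) n≤l)

sum-applyUpTo-+ : ∀ (g : ℕ → ℕ) l t → sum (applyUpTo g (l + t)) ≡ sum (applyUpTo g l) + sum (applyUpTo (λ j → g (l + j)) t)
sum-applyUpTo-+ g zero    t = refl
sum-applyUpTo-+ g (suc l) t = trans (cong (g 0 +_) (sum-applyUpTo-+ (g ∘ suc) l t)) (sym (+-assoc (g 0) _ _))

sumS-map-applyUpTo : ∀ (G : ℕ → FPS) h l m → sumS (map G (applyUpTo h l)) m ≡ sum (applyUpTo (λ i → G (h i) m) l)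
sumS-map-applyUpTo G h zero    m = refl
sumS-map-applyUpTo G h (suc l) m = cong (G (h 0) m +_) (sumS-map-applyUpTo G (h ∘ suc) l m)

xPow-< : ∀ {r m} (F : FPS) → m < r → xPow r F m ≡ 0
xPow-< {r} {m} F m<r rewrite <⇒<ᵇ≡true m<r = refl

xPow-≥ : ∀ {r m} (F : FPS) → r ≤ m → xPow r F m ≡ F (m ∸ r)
xPow-≥ {r} {m} F r≤m rewrite ≤⇒<ᵇ≡false r≤m = refl

sum-xPow-geom : ∀ (G : FPS) a n l → n ≤ l → sum (applyUpTo (λ j → xPow (suc (a + j)) G n) l) ≡ xPow (suc a) (geom G) n
sum-xPow-geom G a       zero          l       _         = sum-applyUpTo-zero l (λ _ → refl)
sum-xPow-geom G (suc a) (suc n)       l       n<l       = sum-xPow-geom G a n l (≤-trans (n≤1+n n) n<l)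
sum-xPow-geom G zero    (suc zero)    (suc l) _         =
  trans (cong (G 0 +_) (sum-xPow-geom G 0 0 l z≤n)) (+-identityʳ (G 0))
sum-xPow-geom G zero    (suc (suc n)) (suc l) (s≤s n<l) =
  trans (cong (G (suc n) +_) (sum-xPow-geom G 0 (suc n) l n<l)) (+-comm (G (suc n)) (geom G n))


-- The recurrence

module _ (b c : ℕ) where

  patterns : ℕ → List (List ℕ)
  patterns a = p123 ∷ p132 ∷ γ a b c ∷ []

  Avoids-topRun++⁻ : ∀ {a n k ρ} → k ≤ n → All (_≤ n ∸ k) ρ →
                     Avoids (topRun (suc n) k ++ ρ) (patterns a) → Avoids ρ (patterns (a ∸ suc (k ∸ 1)))
  Avoids-topRun++⁻ {a} {n} {k} k≤n ρ≤ (no123 ∷ no132 ∷ noγ ∷ []) =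
    no123 ∘ Contains-++ˡ (topRun (suc n) k) ∷ no132 ∘ Contains-++ˡ (topRun (suc n) k)
      ∷ noγ ∘ Contains-topRun++-γ⁺ {a} {b} {c} k≤n ρ≤ ∷ []

  Avoids-topRun++⁺ : ∀ {a n k ρ} → 1 ≤ a → 1 ≤ b → k ≤ n → All (_≤ n ∸ k) ρ →
                     Avoids ρ (patterns (a ∸ suc (k ∸ 1))) → Avoids (topRun (suc n) k ++ ρ) (patterns a)
  Avoids-topRun++⁺ {a} {n} {k} 1≤a 1≤b k≤n ρ≤ (no123 ∷ no132 ∷ noγ ∷ []) =
    no123 ∘ Contains-topRun++-low-first⁻ n k k≤n ρ≤ (s≤s (s≤s z≤n)) (s≤s (s≤s z≤n))
      ∷ no132 ∘ Contains-topRun++-low-first⁻ n k k≤n ρ≤ (s≤s (s≤s z≤n)) (s≤s (s≤s z≤n))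
      ∷ noγ ∘ Contains-topRun++-γ⁻ {a} {b} {c} 1≤a 1≤b k≤n ρ≤ ∷ []

  block : ℕ → ℕ → ℕ → List (List ℕ)
  block a n k = map (topRun (suc n) k ++_) (avoiders (patterns (a ∸ suc (k ∸ 1))) (n ∸ k))

  blocks : ℕ → ℕ → List (List ℕ)
  blocks a n = concat (applyUpTo (block a n) (suc n))

  avoiders⊆blocks : ∀ a n {π} → π ∈ avoiders (patterns a) (suc n) → π ∈ blocks a n
  avoiders⊆blocks a n π∈ with ∈-avoiders⁻ (patterns a) (suc n) π∈
  ... | p , no123 ∷ no132 ∷ av with avoider-shape n p no123 no132
  ...   | k , ρ , k≤n , refl , ρ-perm =
    ∈-concat⁺′ (∈-map⁺ (topRun (suc n) k ++_) ρ∈) (∈-applyUpTo⁺ (block a n) (s≤s k≤n))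
    where
    ρ∈ : ρ ∈ avoiders (patterns (a ∸ suc (k ∸ 1))) (n ∸ k)
    ρ∈ = ∈-avoiders⁺ (patterns (a ∸ suc (k ∸ 1))) (n ∸ k) ρ-perm
           (Avoids-topRun++⁻ {a} k≤n (All.map proj₂ (IsPerm.bounded ρ-perm)) (no123 ∷ no132 ∷ av))

  blocks⊆avoiders : ∀ {a} n {π} → 1 ≤ a → 1 ≤ b → π ∈ blocks a n → π ∈ avoiders (patterns a) (suc n)
  blocks⊆avoiders {a} n 1≤a 1≤b π∈ with ∈-concat⁻′ (applyUpTo (block a n) (suc n)) π∈
  ... | xs , π∈xs , xs∈ with ∈-applyUpTo⁻ (block a n) xs∈
  ...   | k , s≤s k≤n , refl with ∈-map⁻ (topRun (suc n) k ++_) π∈xs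
  ...     | ρ , ρ∈ , refl =
    let (ρ-perm , av) = ∈-avoiders⁻ _ (n ∸ k) ρ∈
    in ∈-avoiders⁺ (patterns a) (suc n) (topRun++-IsPerm k≤n ρ-perm)
         (Avoids-topRun++⁺ 1≤a 1≤b k≤n (All.map proj₂ (IsPerm.bounded ρ-perm)) av)

  blocks-Unique : ∀ a n → Unique (blocks a n)
  blocks-Unique a n = Unique.concat⁺
    (All.applyUpTo⁺₁ (block a n) (suc n) λ {k} _ →
      Unique.map⁺ (λ {ρ} {ρ′} → ++-cancelˡ (topRun (suc n) k) ρ ρ′) (avoiders-Unique (patterns (a ∸ suc (k ∸ 1))) (n ∸ k)))
    (AllPairs.applyUpTo⁺₁ (block a n) (suc n) λ i<j _ (π∈i , π∈j) → <⇒≢ i<j (block-index π∈i π∈j))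
    where
    block-index : ∀ {i j π} → π ∈ block a n i → π ∈ block a n j → i ≡ j
    block-index {i} {j} π∈i π∈j with ∈-map⁻ (topRun (suc n) i ++_) π∈i | ∈-map⁻ (topRun (suc n) j ++_) π∈j
    ... | ρ , _ , refl | ρ′ , _ , eq =
      let runs≡ = ++-∷-cancel (descRange n i) (descRange n j)
                    (λ x∈ → <-irrefl refl (descRange<1+ n i x∈)) (λ x∈ → <-irrefl refl (descRange<1+ n j x∈))
                    (trans (sym (++-assoc (descRange n i) [ suc n ] ρ)) (trans eq (++-assoc (descRange n j) [ suc n ] ρ′)))
      in trans (sym (length-descRange n i)) (trans (cong length runs≡) (length-descRange n j))

  f-recurrence : ∀ a n → 1 ≤ a → 1 ≤ b → f a b c (suc n) ≡ sum (applyUpTo (λ k → f (a ∸ suc (k ∸ 1)) b c (n ∸ k)) (suc n))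
  f-recurrence a n 1≤a 1≤b = begin
    f a b c (suc n)
      ≡⟨ Unique-length-≡ (avoiders-Unique (patterns a) (suc n)) (blocks-Unique a n)
                         (avoiders⊆blocks a n) (blocks⊆avoiders n 1≤a 1≤b) ⟩
    length (blocks a n)
      ≡⟨ length-concat (applyUpTo (block a n) (suc n)) ⟩
    sum (map length (applyUpTo (block a n) (suc n)))
      ≡⟨ cong sum (map-applyUpTo (block a n) length (suc n)) ⟩
    sum (applyUpTo (length ∘ block a n) (suc n))
      ≡⟨ sum-applyUpTo-cong (suc n) (λ {k} _ → length-map (topRun (suc n) k ++_) (avoiders (patterns (a ∸ suc (k ∸ 1))) (n ∸ k))) ⟩
    sum (applyUpTo (λ k → f (a ∸ suc (k ∸ 1)) b c (n ∸ k)) (suc n))  ∎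
    where open ≡-Reasoning

-- The k-th term (k ≥ 1) is the coefficient of x^(n+1) in x^(k+1) F (suc a ∸ k): for k ≤ a these are the
-- middle sum, for k > a they all involve F 0 and add up to the geometric tail.
series-rearrangement : ∀ (F : ℕ → FPS) a n →
  sum (applyUpTo (λ k → F (suc a ∸ suc (k ∸ 1)) (n ∸ k)) (suc n))
    ≡ F a n + sumS (map (λ r → xPow r (F (suc (suc a ∸ r)))) (from2to (suc a))) (suc n)
            + xPow (suc a + 1) (geom (F 0)) (suc n)
series-rearrangement F a n = trans (cong (F a n +_) tail) (sym (+-assoc (F a n) _ _))
  where
  h : ℕ → ℕ
  h i = xPow (suc i) (F (a ∸ i)) n
  S≡ : sumS (map (λ r → xPow r (F (suc (suc a ∸ r)))) (from2to (suc a))) (suc n) ≡ sum (applyUpTo h a)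
  S≡ = trans (sumS-map-applyUpTo (λ r → xPow r (F (suc (suc a ∸ r)))) (_+ 2) a (suc n))
         (sum-applyUpTo-cong a λ {i} i<a →
           trans (cong (λ r → xPow r (F (suc (suc a ∸ r))) (suc n)) (+-comm i 2))
                 (cong (λ x → xPow (suc i) (F x) n) (sym (+-∸-assoc 1 i<a))))
  G≡ : sum (applyUpTo (λ j → h (a + j)) n) ≡ xPow (suc a + 1) (geom (F 0)) (suc n)
  G≡ = begin
    sum (applyUpTo (λ j → h (a + j)) n)
      ≡⟨ sum-applyUpTo-cong n (λ {j} _ → cong (λ x → xPow (suc (a + j)) (F x) n) (m≤n⇒m∸n≡0 (m≤m+n a j))) ⟩
    sum (applyUpTo (λ j → xPow (suc (a + j)) (F 0) n) n)
      ≡⟨ sum-xPow-geom (F 0) a n n ≤-refl ⟩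
    xPow (suc a) (geom (F 0)) n
      ≡⟨ cong (λ r → xPow r (geom (F 0)) n) (+-comm 1 a) ⟩
    xPow (a + 1) (geom (F 0)) n ∎
    where open ≡-Reasoning
  tail : sum (applyUpTo (λ i → F (a ∸ i) (n ∸ suc i)) n)
           ≡ sumS (map (λ r → xPow r (F (suc (suc a ∸ r)))) (from2to (suc a))) (suc n) + xPow (suc a + 1) (geom (F 0)) (suc n)
  tail = begin
    sum (applyUpTo (λ i → F (a ∸ i) (n ∸ suc i)) n)
      ≡⟨ sum-applyUpTo-cong n (λ {i} i<n → sym (xPow-≥ (F (a ∸ i)) i<n)) ⟩
    sum (applyUpTo h n)
      ≡⟨ sum-applyUpTo-extend (λ {i} n≤i → xPow-< (F (a ∸ i)) (s≤s n≤i)) (m≤n+m n a) ⟩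
    sum (applyUpTo h (a + n))
      ≡⟨ sum-applyUpTo-+ h a n ⟩
    sum (applyUpTo h a) + sum (applyUpTo (λ j → h (a + j)) n)
      ≡⟨ cong₂ _+_ (sym S≡) G≡ ⟩
    sumS (map (λ r → xPow r (F (suc (suc a ∸ r)))) (from2to (suc a))) (suc n) + xPow (suc a + 1) (geom (F 0)) (suc n) ∎
    where open ≡-Reasoning

mainTheorem6 : (a b c : ℕ) → 1 ≤ a → 1 ≤ b →
    f a b c ≗ (oneS ⊕ xPow 1 (f (a ∸ 1) b c)
                ⊕ sumS (map (λ r → xPow r (f (suc (a ∸ r)) b c)) (from2to a))
                ⊕ xPow (a + 1) (geom (f 0 b c)))
-- f (suc a) b c 0 evaluates to 1: the empty permutation avoids the three non-empty patterns.
mainTheorem6 (suc a) b c _   _   zero    =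
  cong (λ s → 1 + 0 + s + 0) (sym (trans (sumS-map-applyUpTo _ (_+ 2) a 0)
    (sum-applyUpTo-zero a λ {i} _ → xPow-< (f (suc (suc a ∸ (i + 2))) b c) (subst (0 <_) (+-comm 2 i) (s≤s z≤n)))))
mainTheorem6 (suc a) b c 1≤a 1≤b (suc n) =
  trans (f-recurrence b c (suc a) n 1≤a 1≤b) (series-rearrangement (λ x → f x b c) a n)
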